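{- Let $k\geq3$ and $n$ be positive integers and $x\in\mathbb{F}_{2}^{n\times k}$. Then: (1) the graph $\big([n]\times[k]\times\mathbb{F}_{2},E^{\mathrm{yes}}(x)\big)$ is bipartite; (2) every subset $E'\subseteq E^{\mathrm{no}}(x)$ such that the graph $\big([n]\times[k]\times\mathbb{F}_{2},E'\big)$ is $(k-1)$-colorable satisfies $|E^{\mathrm{no}}(x)\setminus E'|\geq k^{ -2}|E^{\mathrm{no}}(x)|$.
   Context: On the vertex set $[n]\times[k]\times\mathbb{F}_{2}$ define $E^{\mathrm{yes}}(x)=\{\{(a,i,t+x_{a,i}),(b,j,t+x_{b,j}+1)\}: a,b\in[n],\ \{i,j\}\in\binom{[k]}{2},\ t\in\mathbb{F}_{2}\}$ and $E^{\mathrm{no}}(x)=\{\{(a,i,t+x_{a,i}),(b,j,t+x_{b,j})\}: a,b\in[n],\ \{i,j\}\in\binom{[k]}{2},\ t\in\mathbb{F}_{2}\}$. -}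

module Defs where

open import Data.Nat using (ℕ; zero; suc; _+_)
open import Data.Bool using (Bool; true; false; _∧_; _∨_; not; _xor_; if_then_else_)
open import Data.Fin using (Fin)
open import Data.Fin.Properties using () renaming (_≟_ to _≟F_)
open import Data.Product using (_×_; _,_)
open import Data.List using (List; []; _∷_; allFin; cartesianProduct)
open import Data.Bool.ListAction using (any)
open import Relation.Nullary.Decidable using (⌊_⌋)

-- F₂ is modelled by Bool, with addition = _xor_ (false = 0, true = 1).

Vertex : ℕ → ℕ → Set
Vertex n k = Fin n × Fin k × Bool

Assignment : ℕ → ℕ → Set
Assignment n k = Fin n → Fin k → Bool

-- An edge set on V, given as the (decidable) adjacency relation of the
-- unordered pairs {u,v} it contains: E u v = true iff {u,v} ∈ E.
EdgeSet : Set → Set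
EdgeSet V = V → V → Bool

_==F_ : ∀ {m} → Fin m → Fin m → Bool
i ==F j = ⌊ i ≟F j ⌋

_==B_ : Bool → Bool → Bool
a ==B b = not (a xor b)

_==V_ : ∀ {n k} → Vertex n k → Vertex n k → Bool
(a , i , s) ==V (b , j , t) = (a ==F b) ∧ (i ==F j) ∧ (s ==B t)

samePair : ∀ {n k} → Vertex n k → Vertex n k → Vertex n k → Vertex n k → Bool
samePair u v p q = ((u ==V p) ∧ (v ==V q)) ∨ ((u ==V q) ∧ (v ==V p))

allF₂ : List Bool
allF₂ = false ∷ true ∷ []

allVertices : ∀ n k → List (Vertex n k)
allVertices n k = cartesianProduct (allFin n) (cartesianProduct (allFin k) allF₂)

edgeFamily : ∀ {n k} → Bool → Assignment n k → EdgeSet (Vertex n k)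
edgeFamily {n} {k} c x u v =
  any (λ a → any (λ b → any (λ i → any (λ j → any (λ t →
        not (i ==F j) ∧
        samePair u v (a , i , t xor x a i) (b , j , (t xor x b j) xor c))
      allF₂) (allFin k)) (allFin k)) (allFin n)) (allFin n)

-- E^yes(x) = {{(a,i,t+x_{a,i}),(b,j,t+x_{b,j}+1)} : a,b ∈ [n], {i,j} ∈ binom([k],2), t ∈ F₂}
Eyes : ∀ {n k} → Assignment n k → EdgeSet (Vertex n k)
Eyes = edgeFamily true

-- E^no(x) = {{(a,i,t+x_{a,i}),(b,j,t+x_{b,j})} : a,b ∈ [n], {i,j} ∈ binom([k],2), t ∈ F₂}
Eno : ∀ {n k} → Assignment n k → EdgeSet (Vertex n k)
Eno = edgeFamily false

_⊆E_ : ∀ {V} → EdgeSet V → EdgeSet V → Set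
E ⊆E F = ∀ u v → E u v ≡ true → F u v ≡ true
  where open import Relation.Binary.PropositionalEquality using (_≡_)

_∖E_ : ∀ {V} → EdgeSet V → EdgeSet V → EdgeSet V
(E ∖E F) u v = E u v ∧ not (F u v)

open import Relation.Binary.PropositionalEquality using (_≡_)
Symmetric : ∀ {V} → EdgeSet V → Set
Symmetric E = ∀ u v → E u v ≡ E v u

open import Data.Product using (Σ)
open import Relation.Nullary using (¬_)
Colorable : ∀ {V} → ℕ → EdgeSet V → Set
Colorable {V} m E = Σ (V → Fin m) λ c → ∀ u v → E u v ≡ true → ¬ (c u ≡ c v)

Bipartite : ∀ {V} → EdgeSet V → Set
Bipartite E = Colorable 2 E

-- Number of unordered pairs {u,v} (of distinct positions of the list) with E u v = true.
countTrue : ∀ {V : Set} → (V → Bool) → List V → ℕ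
countTrue p [] = 0
countTrue p (y ∷ ys) = (if p y then 1 else 0) + countTrue p ys

pairCount : ∀ {V : Set} → EdgeSet V → List V → ℕ
pairCount E [] = 0
pairCount E (u ∷ us) = countTrue (E u) us + pairCount E us

-- |E| for an edge set (with no loops) on [n]×[k]×F₂.
edgeCount : ∀ {n k} → EdgeSet (Vertex n k) → ℕ
edgeCount {n} {k} E = pairCount E (allVertices n k)

-- Give each vertex (a , i , s) the level s + x a i. An E^yes edge joins vertices of different
-- levels, so the level is a proper 2-colouring. An E^no edge joins vertices of different parts
-- i ≠ j on the same level, so E^no is two disjoint copies of the complete k-partite graph with
-- parts of size n, and has at most k²n² edges. In one copy, let N_c be the colour-class sizes of a
-- (k − 1)-colouring: ∑ N_c = nk, ∑ N_c² counts the ordered monochromatic pairs, of which at most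
-- n²k lie inside a part, and summing 2nN_c ≤ N_c² + n² over the classes leaves at least n²
-- ordered monochromatic pairs across parts. So each copy has at least n²/2 monochromatic edges,
-- all of which a proper colouring of E′ forces into E^no ∖ E′.
module Submission where

open import Defs
open import Data.Nat.Properties
open import Algebra.Properties.CommutativeMonoid.Sum +-0-commutativeMonoid
  using (sum; sum-syntax; sum-cong-≗; ∑-distrib-+; ∑-comm; sum-replicate-zero)
open import Algebra.Properties.Semiring.Sum +-*-semiring using (*-distribˡ-sum; *-distribʳ-sum)
open import Data.Bool using (Bool; true; false; not; _∧_; _xor_; T; if_then_else_)
open import Data.Bool.ListAction using (any)
open import Data.Bool.Properties
  using (T-≡; T-∧; T-∨; ⇔→≡; ∧-conicalˡ; ∧-conicalʳ; ∧-identityʳ; not-¬; true-xor;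
         xor-assoc; xor-comm; xor-same; xor-identityʳ)
open import Data.Fin using (Fin; zero; suc)
open import Data.Fin.Properties using (2↔Bool) renaming (_≟_ to _≟F_)
open import Data.List using ([]; _∷_; _++_; map; tabulate; allFin; cartesianProduct)
open import Data.List.Properties using (map-++; map-∘; map-cong)
open import Data.List.Membership.Propositional using (_∈_; lose)
open import Data.List.Membership.Propositional.Properties using (∈-allFin)
open import Data.List.Relation.Unary.Any using (here; there; satisfied)
open import Data.List.Relation.Unary.Any.Properties using (any⁺; any⁻)
open import Data.Nat using (ℕ; zero; suc; _+_; _*_; _∸_; _≤_; _<_; z≤n; s≤s)
open import Data.Nat.ListAction using () renaming (sum to sumᴸ)
open import Data.Nat.ListAction.Properties using () renaming (sum-++ to sumᴸ-++)
open import Data.Nat.Tactic.RingSolver using (solve-∀)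
open import Data.Product as Product using (_×_; _,_; proj₁; proj₂; map₂)
open import Data.Sum as Sum using (_⊎_; inj₁; inj₂)
open import Function using (_∘_; id; Equivalence; Inverse; mk⇔)
open import Relation.Binary.PropositionalEquality
open import Relation.Nullary using (yes; no; contradiction)
open import Relation.Nullary.Decidable using (toWitness; toWitnessFalse; fromWitnessFalse)

𝟙 : Bool → ℕ
𝟙 b = if b then 1 else 0

𝟙≤1 : ∀ b → 𝟙 b ≤ 1
𝟙≤1 false = z≤n
𝟙≤1 true  = ≤-refl

𝟙-mono : ∀ {b b′} → (b ≡ true → b′ ≡ true) → 𝟙 b ≤ 𝟙 b′
𝟙-mono {false}        _ = z≤n
𝟙-mono {true} {true}  _ = ≤-refl
𝟙-mono {true} {false} b⇒b′ with b⇒b′ refl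
... | ()

𝟙≤𝟙[¬r∧q]+𝟙r : ∀ r q → 𝟙 q ≤ 𝟙 (not r ∧ q) + 𝟙 r
𝟙≤𝟙[¬r∧q]+𝟙r false q = m≤m+n (𝟙 q) 0
𝟙≤𝟙[¬r∧q]+𝟙r true  q = 𝟙≤1 q

==F-refl : ∀ {m} (i : Fin m) → (i ==F i) ≡ true
==F-refl i with i ≟F i
... | yes _   = refl
... | no  i≢i = contradiction refl i≢i

==F-sym : ∀ {m} (i j : Fin m) → (i ==F j) ≡ (j ==F i)
==F-sym i j with i ≟F j | j ≟F i
... | yes _   | yes _   = refl
... | no  _   | no  _   = refl
... | yes i≡j | no  j≢i = contradiction (sym i≡j) j≢i
... | no  i≢j | yes j≡i = contradiction (sym j≡i) i≢j

==F-suc : ∀ {m} (i j : Fin m) → (suc i ==F suc j) ≡ (i ==F j)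
==F-suc i j with i ≟F j
... | yes _ = refl
... | no  _ = refl

∑-mono : ∀ {n} {f g : Fin n → ℕ} → (∀ i → f i ≤ g i) → sum f ≤ sum g
∑-mono {zero}  f≤g = z≤n
∑-mono {suc n} f≤g = +-mono-≤ (f≤g zero) (∑-mono (f≤g ∘ suc))

∑-const : ∀ n c → ∑[ i < n ] c ≡ n * c
∑-const zero    c = refl
∑-const (suc n) c = cong (c +_) (∑-const n c)

∑-δ : ∀ {m} (p : Fin m) (f : Fin m → ℕ) → ∑[ c < m ] (𝟙 (p ==F c) * f c) ≡ f p
∑-δ {suc m} zero    f = trans (cong₂ _+_ (+-identityʳ (f zero)) (sum-replicate-zero m)) (+-identityʳ (f zero))
∑-δ {suc m} (suc p) f =
  trans (sum-cong-≗ {m} λ c → cong (λ b → 𝟙 b * f (suc c)) (==F-suc p c)) (∑-δ p (f ∘ suc))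

∑-𝟙==F : ∀ {m} (p : Fin m) → ∑[ c < m ] 𝟙 (p ==F c) ≡ 1
∑-𝟙==F {m} p = trans (sum-cong-≗ {m} λ c → sym (*-identityʳ _)) (∑-δ p λ _ → 1)

𝟙==F-as-∑ : ∀ {m} (p q : Fin m) → 𝟙 (p ==F q) ≡ ∑[ c < m ] (𝟙 (p ==F c) * 𝟙 (q ==F c))
𝟙==F-as-∑ p q = trans (cong 𝟙 (==F-sym p q)) (sym (∑-δ p λ c → 𝟙 (q ==F c)))

∑∑ : ∀ {n k} → (Fin n → Fin k → ℕ) → ℕ
∑∑ {n} {k} f = ∑[ a < n ] ∑[ i < k ] f a i

∑∑-cong : ∀ {n k} {f g : Fin n → Fin k → ℕ} → (∀ a i → f a i ≡ g a i) → ∑∑ f ≡ ∑∑ g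
∑∑-cong {n} {k} f≡g = sum-cong-≗ {n} λ a → sum-cong-≗ {k} (f≡g a)

∑∑-mono : ∀ {n k} {f g : Fin n → Fin k → ℕ} → (∀ a i → f a i ≤ g a i) → ∑∑ f ≤ ∑∑ g
∑∑-mono f≤g = ∑-mono λ a → ∑-mono (f≤g a)

∑∑-distrib-+ : ∀ {n k} (f g : Fin n → Fin k → ℕ) → ∑∑ (λ a i → f a i + g a i) ≡ ∑∑ f + ∑∑ g
∑∑-distrib-+ {n} {k} f g =
  trans (sum-cong-≗ {n} λ a → ∑-distrib-+ (f a) (g a))
        (∑-distrib-+ (λ a → ∑[ i < k ] f a i) (λ a → ∑[ i < k ] g a i))

∑∑-const : ∀ n k c → ∑∑ {n} {k} (λ _ _ → c) ≡ n * (k * c)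
∑∑-const n k c = trans (sum-cong-≗ {n} λ _ → ∑-const k c) (∑-const n (k * c))

∑∑-comm : ∀ {n k m} (f : Fin n → Fin k → Fin m → ℕ) →
          ∑∑ (λ a i → ∑[ c < m ] f a i c) ≡ ∑[ c < m ] ∑∑ (λ a i → f a i c)
∑∑-comm {n} {k} {m} f = trans (sum-cong-≗ {n} λ a → ∑-comm (f a)) (∑-comm λ a c → ∑[ i < k ] f a i c)

*-distribˡ-∑∑ : ∀ {n k} c (f : Fin n → Fin k → ℕ) → c * ∑∑ f ≡ ∑∑ (λ a i → c * f a i)
*-distribˡ-∑∑ {n} {k} c f =
  trans (*-distribˡ-sum c λ a → ∑[ i < k ] f a i) (sum-cong-≗ {n} λ a → *-distribˡ-sum c (f a))

*-distribʳ-∑∑ : ∀ {n k} c (f : Fin n → Fin k → ℕ) → ∑∑ f * c ≡ ∑∑ (λ a i → f a i * c)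
*-distribʳ-∑∑ {n} {k} c f =
  trans (*-distribʳ-sum c λ a → ∑[ i < k ] f a i) (sum-cong-≗ {n} λ a → *-distribʳ-sum c (f a))

m≤n⇒2*m*n≤m*m+n*n : ∀ {m n} → m ≤ n → 2 * (m * n) ≤ m * m + n * n
m≤n⇒2*m*n≤m*m+n*n {m} m≤n with m≤n⇒∃[o]m+o≡n m≤n
... | d , refl = ≤-trans (m≤m+n _ (d * d)) (≤-reflexive (expand m d))
  where
  expand : ∀ m d → 2 * (m * (m + d)) + d * d ≡ m * m + (m + d) * (m + d)
  expand = solve-∀

2*m*n≤m*m+n*n : ∀ m n → 2 * (m * n) ≤ m * m + n * n
2*m*n≤m*m+n*n m n with ≤-total m n
... | inj₁ m≤n = m≤n⇒2*m*n≤m*m+n*n m≤n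
... | inj₂ n≤m = subst₂ _≤_ (cong (2 *_) (*-comm n m)) (+-comm (n * n) (m * m)) (m≤n⇒2*m*n≤m*m+n*n n≤m)

-- C a i is the colour of the a-th vertex of part i of the complete k-partite graph with parts of size n.
module _ {n k m : ℕ} (C : Fin n → Fin k → Fin m) where

  colourClassSize : Fin m → ℕ
  colourClassSize c = ∑∑ λ a i → 𝟙 (C a i ==F c)

  monochromaticPairs : ℕ
  monochromaticPairs = ∑∑ λ a i → ∑∑ λ b j → 𝟙 (C a i ==F C b j)

  crossMonochromaticPairs : ℕ
  crossMonochromaticPairs = ∑∑ λ a i → ∑∑ λ b j → 𝟙 (not (i ==F j) ∧ (C a i ==F C b j))

  ∑-colourClassSize : ∑[ c < m ] colourClassSize c ≡ n * (k * 1)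
  ∑-colourClassSize = begin
    ∑[ c < m ] colourClassSize c              ≡⟨ ∑∑-comm (λ a i c → 𝟙 (C a i ==F c)) ⟨
    ∑∑ (λ a i → ∑[ c < m ] 𝟙 (C a i ==F c))  ≡⟨ ∑∑-cong (λ a i → ∑-𝟙==F (C a i)) ⟩
    ∑∑ {n} {k} (λ _ _ → 1)                    ≡⟨ ∑∑-const n k 1 ⟩
    n * (k * 1)                               ∎
    where open ≡-Reasoning

  monochromaticPairs≡∑colourClassSize² :
    monochromaticPairs ≡ ∑[ c < m ] (colourClassSize c * colourClassSize c)
  monochromaticPairs≡∑colourClassSize² = begin
    monochromaticPairs
      ≡⟨ ∑∑-cong (λ a i → ∑∑-cong λ b j → 𝟙==F-as-∑ (C a i) (C b j)) ⟩
    ∑∑ (λ a i → ∑∑ λ b j → ∑[ c < m ] (e a i c * e b j c))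
      ≡⟨ ∑∑-cong (λ a i → ∑∑-comm λ b j c → e a i c * e b j c) ⟩
    ∑∑ (λ a i → ∑[ c < m ] ∑∑ λ b j → e a i c * e b j c)
      ≡⟨ ∑∑-comm (λ a i c → ∑∑ λ b j → e a i c * e b j c) ⟩
    ∑[ c < m ] ∑∑ (λ a i → ∑∑ λ b j → e a i c * e b j c)
      ≡⟨ sum-cong-≗ {m} (λ c → ∑∑-cong λ a i → *-distribˡ-∑∑ (e a i c) λ b j → e b j c) ⟨
    ∑[ c < m ] ∑∑ (λ a i → e a i c * colourClassSize c)
      ≡⟨ sum-cong-≗ {m} (λ c → *-distribʳ-∑∑ (colourClassSize c) λ a i → e a i c) ⟨
    ∑[ c < m ] (colourClassSize c * colourClassSize c)
      ∎
    where
    open ≡-Reasoning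
    e : Fin n → Fin k → Fin m → ℕ
    e a i c = 𝟙 (C a i ==F c)

  monochromaticPairs≤crossMonochromaticPairs+n*k*n :
    monochromaticPairs ≤ crossMonochromaticPairs + n * (k * (n * 1))
  monochromaticPairs≤crossMonochromaticPairs+n*k*n = begin
    monochromaticPairs
      ≤⟨ ∑∑-mono (λ a i → ∑∑-mono λ b j → 𝟙≤𝟙[¬r∧q]+𝟙r (i ==F j) (C a i ==F C b j)) ⟩
    ∑∑ (λ a i → ∑∑ λ b j → cross a i b j + samePart a i b j)
      ≡⟨ ∑∑-cong (λ a i → ∑∑-distrib-+ (cross a i) (samePart a i)) ⟩
    ∑∑ (λ a i → ∑∑ (cross a i) + ∑∑ (samePart a i))
      ≡⟨ ∑∑-distrib-+ (λ a i → ∑∑ (cross a i)) (λ a i → ∑∑ (samePart a i)) ⟩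
    crossMonochromaticPairs + ∑∑ (λ a i → ∑∑ (samePart a i))
      ≡⟨ cong (crossMonochromaticPairs +_) samePartPairs ⟩
    crossMonochromaticPairs + n * (k * (n * 1))
      ∎
    where
    open ≤-Reasoning
    cross : Fin n → Fin k → Fin n → Fin k → ℕ
    cross a i b j = 𝟙 (not (i ==F j) ∧ (C a i ==F C b j))
    samePart : Fin n → Fin k → Fin n → Fin k → ℕ
    samePart a i b j = 𝟙 (i ==F j)
    samePartPairs : ∑∑ (λ a i → ∑∑ (samePart a i)) ≡ n * (k * (n * 1))
    samePartPairs = trans (∑∑-cong {n} {k} λ a i → trans (sum-cong-≗ {n} λ b → ∑-𝟙==F i) (∑-const n 1))
                          (∑∑-const n k (n * 1))

  crossMonochromaticPairs-lowerBound : k * (n * n) ≤ crossMonochromaticPairs + m * (n * n)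
  crossMonochromaticPairs-lowerBound = +-cancelʳ-≤ (k * (n * n)) _ _ (begin
    k * (n * n) + k * (n * n)
      ≡⟨ doubled n k ⟩
    2 * (n * (n * (k * 1)))
      ≡⟨ cong (λ s → 2 * (n * s)) ∑-colourClassSize ⟨
    2 * (n * ∑[ c < m ] N c)
      ≡⟨ cong (2 *_) (*-distribˡ-sum n N) ⟩
    2 * ∑[ c < m ] (n * N c)
      ≡⟨ *-distribˡ-sum 2 (λ c → n * N c) ⟩
    ∑[ c < m ] (2 * (n * N c))
      ≤⟨ ∑-mono (λ c → 2*m*n≤m*m+n*n n (N c)) ⟩
    ∑[ c < m ] (n * n + N c * N c)
      ≡⟨ ∑-distrib-+ (λ _ → n * n) (λ c → N c * N c) ⟩
    ∑[ c < m ] (n * n) + ∑[ c < m ] (N c * N c)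
      ≡⟨ cong₂ _+_ (∑-const m (n * n)) (sym monochromaticPairs≡∑colourClassSize²) ⟩
    m * (n * n) + monochromaticPairs
      ≤⟨ +-monoʳ-≤ (m * (n * n)) monochromaticPairs≤crossMonochromaticPairs+n*k*n ⟩
    m * (n * n) + (crossMonochromaticPairs + n * (k * (n * 1)))
      ≡⟨ rearrange n k m crossMonochromaticPairs ⟩
    crossMonochromaticPairs + m * (n * n) + k * (n * n)
      ∎)
    where
    open ≤-Reasoning
    N : Fin m → ℕ
    N = colourClassSize
    doubled : ∀ n k → k * (n * n) + k * (n * n) ≡ 2 * (n * (n * (k * 1)))
    doubled = solve-∀
    rearrange : ∀ n k m s → m * (n * n) + (s + n * (k * (n * 1))) ≡ s + m * (n * n) + k * (n * n)
    rearrange = solve-∀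

  fewerColoursThanParts⇒n*n≤crossMonochromaticPairs : m < k → n * n ≤ crossMonochromaticPairs
  fewerColoursThanParts⇒n*n≤crossMonochromaticPairs m<k = +-cancelʳ-≤ (m * (n * n)) _ _ (begin
    suc m * (n * n)                         ≤⟨ *-monoˡ-≤ (n * n) m<k ⟩
    k * (n * n)                             ≤⟨ crossMonochromaticPairs-lowerBound ⟩
    crossMonochromaticPairs + m * (n * n)   ∎)
    where open ≤-Reasoning

countTrue≡sumᴸ : ∀ {A : Set} (p : A → Bool) xs → countTrue p xs ≡ sumᴸ (map (𝟙 ∘ p) xs)
countTrue≡sumᴸ p []       = refl
countTrue≡sumᴸ p (y ∷ ys) = cong (𝟙 (p y) +_) (countTrue≡sumᴸ p ys)

countTrue-mono : ∀ {A : Set} {p q : A → Bool} → (∀ y → p y ≡ true → q y ≡ true) →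
                 ∀ ys → countTrue p ys ≤ countTrue q ys
countTrue-mono p⇒q []       = z≤n
countTrue-mono p⇒q (y ∷ ys) = +-mono-≤ (𝟙-mono (p⇒q y)) (countTrue-mono p⇒q ys)

pairCount-mono : ∀ {V : Set} {P Q : EdgeSet V} → P ⊆E Q → ∀ us → pairCount P us ≤ pairCount Q us
pairCount-mono P⊆Q []       = z≤n
pairCount-mono P⊆Q (u ∷ us) = +-mono-≤ (countTrue-mono (P⊆Q u) us) (pairCount-mono P⊆Q us)

sumᴸ-map-+ : ∀ {A : Set} (f g : A → ℕ) xs →
             sumᴸ (map (λ y → f y + g y) xs) ≡ sumᴸ (map f xs) + sumᴸ (map g xs)
sumᴸ-map-+ f g []       = refl
sumᴸ-map-+ f g (y ∷ ys) = trans (cong (f y + g y +_) (sumᴸ-map-+ f g ys)) (interchange (f y) (g y) _ _)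
  where
  interchange : ∀ a b c d → a + b + (c + d) ≡ a + c + (b + d)
  interchange = solve-∀

pairCount-double : ∀ {V : Set} (P : EdgeSet V) → Symmetric P → (∀ u → P u u ≡ false) → ∀ us →
                   2 * pairCount P us ≡ sumᴸ (map (λ u → countTrue (P u) us) us)
pairCount-double P P-sym P-irrefl []       = refl
pairCount-double P P-sym P-irrefl (u ∷ us) = begin
  2 * (countTrue (P u) us + pairCount P us)
    ≡⟨ regroup (countTrue (P u) us) (pairCount P us) ⟩
  countTrue (P u) us + (countTrue (P u) us + 2 * pairCount P us)
    ≡⟨ cong₂ (λ d s → countTrue (P u) us + (d + s)) column (pairCount-double P P-sym P-irrefl us) ⟩
  countTrue (P u) us + (sumᴸ (map (λ w → 𝟙 (P w u)) us) + sumᴸ (map (λ w → countTrue (P w) us) us))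
    ≡⟨ cong₂ _+_ (cong (λ b → 𝟙 b + countTrue (P u) us) (P-irrefl u))
                 (sumᴸ-map-+ (λ w → 𝟙 (P w u)) (λ w → countTrue (P w) us) us) ⟨
  countTrue (P u) (u ∷ us) + sumᴸ (map (λ w → countTrue (P w) (u ∷ us)) us)
    ∎
  where
  open ≡-Reasoning
  regroup : ∀ d s → 2 * (d + s) ≡ d + (d + 2 * s)
  regroup = solve-∀
  column : countTrue (P u) us ≡ sumᴸ (map (λ w → 𝟙 (P w u)) us)
  column = trans (countTrue≡sumᴸ (P u) us) (cong sumᴸ (map-cong (λ w → cong 𝟙 (P-sym u w)) us))

sumᴸ-map-tabulate : ∀ {A : Set} {n} (f : A → ℕ) (g : Fin n → A) →
                    sumᴸ (map f (tabulate g)) ≡ ∑[ i < n ] f (g i)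
sumᴸ-map-tabulate {n = zero}  f g = refl
sumᴸ-map-tabulate {n = suc n} f g = cong (f (g zero) +_) (sumᴸ-map-tabulate f (g ∘ suc))

sumᴸ-map-cartesianProduct : ∀ {A B : Set} (f : A × B → ℕ) xs ys →
  sumᴸ (map f (cartesianProduct xs ys)) ≡ sumᴸ (map (λ a → sumᴸ (map (λ b → f (a , b)) ys)) xs)
sumᴸ-map-cartesianProduct f []       ys = refl
sumᴸ-map-cartesianProduct f (a ∷ xs) ys = begin
  sumᴸ (map f (map (a ,_) ys ++ cartesianProduct xs ys))
    ≡⟨ cong sumᴸ (map-++ f (map (a ,_) ys) (cartesianProduct xs ys)) ⟩
  sumᴸ (map f (map (a ,_) ys) ++ map f (cartesianProduct xs ys))
    ≡⟨ sumᴸ-++ (map f (map (a ,_) ys)) (map f (cartesianProduct xs ys)) ⟩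
  sumᴸ (map f (map (a ,_) ys)) + sumᴸ (map f (cartesianProduct xs ys))
    ≡⟨ cong₂ _+_ (cong sumᴸ (sym (map-∘ ys))) (sumᴸ-map-cartesianProduct f xs ys) ⟩
  sumᴸ (map (λ b → f (a , b)) ys) + sumᴸ (map (λ a → sumᴸ (map (λ b → f (a , b)) ys)) xs)
    ∎
  where open ≡-Reasoning

monochromaticEdges : ∀ {V : Set} {m} → EdgeSet V → (V → Fin m) → EdgeSet V
monochromaticEdges E col u v = E u v ∧ (col u ==F col v)

monochromaticEdges-sym : ∀ {V : Set} {m} (E : EdgeSet V) (col : V → Fin m) →
                         Symmetric E → Symmetric (monochromaticEdges E col)
monochromaticEdges-sym E col E-sym u v = cong₂ _∧_ (E-sym u v) (==F-sym (col u) (col v))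

monochromaticEdges⊆∖ : ∀ {V : Set} {m} (E E′ : EdgeSet V) (col : V → Fin m) →
                       (∀ u v → E′ u v ≡ true → col u ≢ col v) → monochromaticEdges E col ⊆E (E ∖E E′)
monochromaticEdges⊆∖ E E′ col proper u v mono with E′ u v in e
... | true  = contradiction (toWitness {a? = col u ≟F col v} (Equivalence.from T-≡ (∧-conicalʳ _ _ mono)))
                            (proper u v e)
... | false = trans (∧-identityʳ (E u v)) (∧-conicalˡ _ _ mono)

xor-cancelʳ : ∀ s y → (s xor y) xor y ≡ s
xor-cancelʳ s y = trans (xor-assoc s y y) (trans (cong (s xor_) (xor-same y)) (xor-identityʳ s))

xor-swapʳ : ∀ s y z → (s xor y) xor z ≡ (s xor z) xor y
xor-swapʳ s y z = trans (xor-assoc s y z) (trans (cong (s xor_) (xor-comm y z)) (sym (xor-assoc s z y)))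

∈-allF₂ : ∀ t → t ∈ allF₂
∈-allF₂ false = here refl
∈-allF₂ true  = there (here refl)

xor-shift-sym : ∀ {s t} c → s ≡ t xor c → t ≡ s xor c
xor-shift-sym {t = t} c s≡t+c = sym (trans (cong (_xor c) s≡t+c) (xor-cancelʳ t c))

any-allFin⁺ : ∀ {n} (p : Fin n → Bool) i → T (p i) → T (any p (allFin n))
any-allFin⁺ p i = any⁺ p ∘ lose (∈-allFin i)

any-allF₂⁺ : ∀ (p : Bool → Bool) t → T (p t) → T (any p allF₂)
any-allF₂⁺ p t = any⁺ p ∘ lose (∈-allF₂ t)

part : ∀ {n k} → Vertex n k → Fin k
part (_ , i , _) = i

-- The vertex (a , i , t + x a i) of the paper has level t.
level : ∀ {n k} → Assignment n k → Vertex n k → Bool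
level x (a , i , s) = s xor x a i

vertexAt : ∀ {n k} → Assignment n k → Bool → Fin n → Fin k → Vertex n k
vertexAt x t a i = a , i , t xor x a i

level-vertexAt : ∀ {n k} (x : Assignment n k) t a i → level x (vertexAt x t a i) ≡ t
level-vertexAt x t a i = xor-cancelʳ t (x a i)

==B-sound : ∀ s t → T (s ==B t) → s ≡ t
==B-sound false false _ = refl
==B-sound true  true  _ = refl

==B-refl : ∀ s → T (s ==B s)
==B-refl false = _
==B-refl true  = _

==V-sound : ∀ {n k} {u v : Vertex n k} → T (u ==V v) → u ≡ v
==V-sound {u = a , i , s} {b , j , t} u=v
  with Equivalence.to T-∧ u=v
... | a=b , i=j∧s=t with Equivalence.to T-∧ i=j∧s=t
... | i=j , s=t with toWitness {a? = a ≟F b} a=b | toWitness {a? = i ≟F j} i=j | ==B-sound s t s=t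
... | refl | refl | refl = refl

==V-refl : ∀ {n k} (u : Vertex n k) → T (u ==V u)
==V-refl (a , i , s) rewrite ==F-refl a | ==F-refl i = ==B-refl s

samePair-sound : ∀ {n k} (u v p q : Vertex n k) → T (samePair u v p q) → (u ≡ p × v ≡ q) ⊎ (u ≡ q × v ≡ p)
samePair-sound u v p q same =
  Sum.map (Product.map ==V-sound ==V-sound ∘ Equivalence.to T-∧)
          (Product.map ==V-sound ==V-sound ∘ Equivalence.to T-∧)
          (Equivalence.to T-∨ same)

samePair-refl : ∀ {n k} (u v : Vertex n k) → T (samePair u v u v)
samePair-refl u v = Equivalence.from T-∨ (inj₁ (Equivalence.from T-∧ (==V-refl u , ==V-refl v)))

generator-levels : ∀ {n k} (x : Assignment n k) c t a i b j →
                   level x (b , j , (t xor x b j) xor c) ≡ level x (vertexAt x t a i) xor c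
generator-levels x c t a i b j = begin
  level x (b , j , (t xor x b j) xor c)   ≡⟨ cong (_xor x b j) (xor-swapʳ t (x b j) c) ⟩
  ((t xor c) xor x b j) xor x b j         ≡⟨ xor-cancelʳ (t xor c) (x b j) ⟩
  t xor c                                 ≡⟨ cong (_xor c) (level-vertexAt x t a i) ⟨
  level x (vertexAt x t a i) xor c        ∎
  where open ≡-Reasoning

module _ {n k : ℕ} (c : Bool) (x : Assignment n k) (u v : Vertex n k) where

  generates : Fin n → Fin n → Fin k → Fin k → Bool → Bool
  generates a b i j t = not (i ==F j) ∧ samePair u v (vertexAt x t a i) (b , j , (t xor x b j) xor c)

  -- edgeFamily c x u v is definitionally any search₁ (allFin n); naming the stages lets any⁻ and
  -- any⁺ be applied without asking Agda to solve for the anonymous predicates of the definition.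
  private
    search₄ : Fin n → Fin n → Fin k → Fin k → Bool
    search₄ a b i j = any (generates a b i j) allF₂
    search₃ : Fin n → Fin n → Fin k → Bool
    search₃ a b i = any (search₄ a b i) (allFin k)
    search₂ : Fin n → Fin n → Bool
    search₂ a b = any (search₃ a b) (allFin k)
    search₁ : Fin n → Bool
    search₁ a = any (search₂ a) (allFin n)

  edgeFamily-sound : edgeFamily c x u v ≡ true → part u ≢ part v × level x v ≡ level x u xor c
  edgeFamily-sound e
    with satisfied (any⁻ search₁ (allFin n) (Equivalence.from T-≡ e))
  ... | a , e₁ with satisfied (any⁻ (search₂ a) (allFin n) e₁)
  ... | b , e₂ with satisfied (any⁻ (search₃ a b) (allFin k) e₂)
  ... | i , e₃ with satisfied (any⁻ (search₄ a b i) (allFin k) e₃)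
  ... | j , e₄ with satisfied (any⁻ (generates a b i j) allF₂ e₄)
  ... | t , e₅ with Equivalence.to T-∧ e₅
  ... | i≢j , same with samePair-sound u v (vertexAt x t a i) (b , j , (t xor x b j) xor c) same
  ... | inj₁ (refl , refl) = toWitnessFalse {a? = i ≟F j} i≢j , generator-levels x c t a i b j
  ... | inj₂ (refl , refl) =
    toWitnessFalse {a? = i ≟F j} i≢j ∘ sym , xor-shift-sym c (generator-levels x c t a i b j)

  edgeFamily-complete : part u ≢ part v → level x v ≡ level x u xor c → edgeFamily c x u v ≡ true
  edgeFamily-complete i≢j shifted = Equivalence.to T-≡
    (any-allFin⁺ search₁ a (any-allFin⁺ (search₂ a) b (any-allFin⁺ (search₃ a b) i
      (any-allFin⁺ (search₄ a b i) j (any-allF₂⁺ (generates a b i j) t generated)))))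
    where
    a b : Fin n
    a = proj₁ u
    b = proj₁ v
    i j : Fin k
    i = part u
    j = part v
    t : Bool
    t = level x u
    p≡u : vertexAt x t a i ≡ u
    p≡u = cong (λ s → a , i , s) (xor-cancelʳ (proj₂ (proj₂ u)) (x a i))
    q≡v : (b , j , (t xor x b j) xor c) ≡ v
    q≡v = cong (λ s → b , j , s) (begin
      (t xor x b j) xor c      ≡⟨ xor-swapʳ t (x b j) c ⟩
      (t xor c) xor x b j      ≡⟨ cong (_xor x b j) shifted ⟨
      level x v xor x b j      ≡⟨ xor-cancelʳ (proj₂ (proj₂ v)) (x b j) ⟩
      proj₂ (proj₂ v)          ∎)
      where open ≡-Reasoning
    generated : T (generates a b i j t)
    generated = Equivalence.from T-∧
      ( fromWitnessFalse {a? = i ≟F j} i≢j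
      , subst₂ (λ p q → T (samePair u v p q)) (sym p≡u) (sym q≡v) (samePair-refl u v))

module _ {n k : ℕ} (x : Assignment n k) where

  Eyes-bipartite : Bipartite (Eyes x)
  Eyes-bipartite = colour , proper
    where
    colour : Vertex n k → Fin 2
    colour = Inverse.from 2↔Bool ∘ level x
    proper : ∀ u v → Eyes x u v ≡ true → colour u ≢ colour v
    proper u v e same = not-¬ (sym levels-equal) flipped
      where
      levels-equal : level x u ≡ level x v
      levels-equal = trans (sym (Inverse.strictlyInverseˡ 2↔Bool (level x u)))
                           (trans (cong (Inverse.to 2↔Bool) same) (Inverse.strictlyInverseˡ 2↔Bool (level x v)))
      flipped : level x v ≡ not (level x u)
      flipped = trans (proj₂ (edgeFamily-sound true x u v e)) (trans (xor-comm _ true) (true-xor _))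

  Eno-sound : ∀ u v → Eno x u v ≡ true → part u ≢ part v × level x v ≡ level x u
  Eno-sound u v e = map₂ (λ shifted → trans shifted (xor-identityʳ _)) (edgeFamily-sound false x u v e)

  Eno-complete : ∀ u v → part u ≢ part v → level x v ≡ level x u → Eno x u v ≡ true
  Eno-complete u v i≢j same = edgeFamily-complete false x u v i≢j (trans same (sym (xor-identityʳ _)))

  Eno-sym : Symmetric (Eno x)
  Eno-sym u v = ⇔→≡ {z = true} (mk⇔ (flip u v) (flip v u))
    where
    flip : ∀ u v → Eno x u v ≡ true → Eno x v u ≡ true
    flip u v e = let i≢j , same = Eno-sound u v e in Eno-complete v u (i≢j ∘ sym) (sym same)

  Eno-irrefl : ∀ u → Eno x u u ≡ false
  Eno-irrefl u with Eno x u u in e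
  ... | false = refl
  ... | true  = contradiction refl (proj₁ (Eno-sound u u e))

  levelSum : Bool → (Vertex n k → ℕ) → ℕ
  levelSum t f = ∑∑ λ a i → f (vertexAt x t a i)

  sumᴸ-allVertices : ∀ f → sumᴸ (map f (allVertices n k)) ≡ levelSum false f + levelSum true f
  sumᴸ-allVertices f = begin
    sumᴸ (map f (allVertices n k))
      ≡⟨ sumᴸ-map-cartesianProduct f (allFin n) (cartesianProduct (allFin k) allF₂) ⟩
    sumᴸ (map cell (allFin n))
      ≡⟨ sumᴸ-map-tabulate cell id ⟩
    ∑[ a < n ] cell a
      ≡⟨ sum-cong-≗ {n} (λ a → trans (sumᴸ-map-cartesianProduct (λ p → f (a , p)) (allFin k) allF₂)
                                     (sumᴸ-map-tabulate (λ i → sumᴸ (map (λ s → f (a , i , s)) allF₂)) id)) ⟩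
    ∑∑ (λ a i → f (a , i , false) + (f (a , i , true) + 0))
      ≡⟨ ∑∑-cong (λ a i → bothLevels (λ s → f (a , i , s)) (x a i)) ⟩
    ∑∑ (λ a i → f (vertexAt x false a i) + f (vertexAt x true a i))
      ≡⟨ ∑∑-distrib-+ (λ a i → f (vertexAt x false a i)) (λ a i → f (vertexAt x true a i)) ⟩
    levelSum false f + levelSum true f
      ∎
    where
    open ≡-Reasoning
    cell : Fin n → ℕ
    cell a = sumᴸ (map (λ p → f (a , p)) (cartesianProduct (allFin k) allF₂))
    bothLevels : ∀ (g : Bool → ℕ) y → g false + (g true + 0) ≡ g (false xor y) + g (true xor y)
    bothLevels g false = cong (g false +_) (+-identityʳ (g true))
    bothLevels g true  = trans (cong (g false +_) (+-identityʳ (g true))) (+-comm (g false) (g true))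

  levelSum≤sumᴸ-allVertices : ∀ f t → levelSum t f ≤ sumᴸ (map f (allVertices n k))
  levelSum≤sumᴸ-allVertices f false = ≤-trans (m≤m+n _ _) (≤-reflexive (sym (sumᴸ-allVertices f)))
  levelSum≤sumᴸ-allVertices f true  = ≤-trans (m≤n+m _ _) (≤-reflexive (sym (sumᴸ-allVertices f)))

  levelSum-offLevel : ∀ f t → (∀ v → level x v ≢ t → f v ≡ 0) → ∀ s → s ≢ t → levelSum s f ≡ 0
  levelSum-offLevel f t off s s≢t = begin
    levelSum s f            ≡⟨ ∑∑-cong (λ a i → off _ (s≢t ∘ trans (sym (level-vertexAt x s a i)))) ⟩
    ∑∑ {n} {k} (λ _ _ → 0)  ≡⟨ ∑∑-const n k 0 ⟩
    n * (k * 0)             ≡⟨ cong (n *_) (*-zeroʳ k) ⟩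
    n * 0                   ≡⟨ *-zeroʳ n ⟩
    0                       ∎
    where open ≡-Reasoning

  sumᴸ-allVertices-atLevel : ∀ f t → (∀ v → level x v ≢ t → f v ≡ 0) →
                             sumᴸ (map f (allVertices n k)) ≡ levelSum t f
  sumᴸ-allVertices-atLevel f false off = trans (sumᴸ-allVertices f)
    (trans (cong (levelSum false f +_) (levelSum-offLevel f false off true λ ())) (+-identityʳ _))
  sumᴸ-allVertices-atLevel f true  off = trans (sumᴸ-allVertices f)
    (cong (_+ levelSum true f) (levelSum-offLevel f true off false λ ()))

  Eno-degree≤ : ∀ u → countTrue (Eno x u) (allVertices n k) ≤ n * (k * 1)
  Eno-degree≤ u = begin
    countTrue (Eno x u) (allVertices n k)
      ≡⟨ countTrue≡sumᴸ (Eno x u) (allVertices n k) ⟩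
    sumᴸ (map (𝟙 ∘ Eno x u) (allVertices n k))
      ≡⟨ sumᴸ-allVertices-atLevel (𝟙 ∘ Eno x u) (level x u) offLevel ⟩
    levelSum (level x u) (𝟙 ∘ Eno x u)
      ≤⟨ ∑∑-mono (λ a i → 𝟙≤1 (Eno x u (vertexAt x (level x u) a i))) ⟩
    ∑∑ {n} {k} (λ _ _ → 1)
      ≡⟨ ∑∑-const n k 1 ⟩
    n * (k * 1)
      ∎
    where
    open ≤-Reasoning
    offLevel : ∀ v → level x v ≢ level x u → 𝟙 (Eno x u v) ≡ 0
    offLevel v v-off with Eno x u v in e
    ... | false = refl
    ... | true  = contradiction (proj₂ (Eno-sound u v e)) v-off

  edgeCount-Eno≤k*k*n*n : edgeCount (Eno x) ≤ k * k * (n * n)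
  edgeCount-Eno≤k*k*n*n = *-cancelˡ-≤ 2 (begin
    2 * edgeCount (Eno x)
      ≡⟨ pairCount-double (Eno x) Eno-sym Eno-irrefl (allVertices n k) ⟩
    sumᴸ (map degree (allVertices n k))
      ≡⟨ sumᴸ-allVertices degree ⟩
    levelSum false degree + levelSum true degree
      ≤⟨ +-mono-≤ (∑∑-mono λ a i → Eno-degree≤ (vertexAt x false a i))
                  (∑∑-mono λ a i → Eno-degree≤ (vertexAt x true a i)) ⟩
    ∑∑ {n} {k} (λ _ _ → n * (k * 1)) + ∑∑ {n} {k} (λ _ _ → n * (k * 1))
      ≡⟨ cong₂ _+_ (∑∑-const n k (n * (k * 1))) (∑∑-const n k (n * (k * 1))) ⟩
    n * (k * (n * (k * 1))) + n * (k * (n * (k * 1)))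
      ≡⟨ doubled n k ⟩
    2 * (k * k * (n * n))
      ∎)
    where
    open ≤-Reasoning
    degree : Vertex n k → ℕ
    degree u = countTrue (Eno x u) (allVertices n k)
    doubled : ∀ n k → n * (k * (n * (k * 1))) + n * (k * (n * (k * 1))) ≡ 2 * (k * k * (n * n))
    doubled = solve-∀

  n*n≤edgeCount-monochromaticEno : ∀ {m} (col : Vertex n k → Fin m) → m < k →
                                  n * n ≤ edgeCount (monochromaticEdges (Eno x) col)
  n*n≤edgeCount-monochromaticEno {m} col m<k = *-cancelˡ-≤ 2 (begin
    2 * (n * n)
      ≡⟨ cong (n * n +_) (+-identityʳ (n * n)) ⟩
    n * n + n * n
      ≤⟨ +-mono-≤ (fewerColoursThanParts⇒n*n≤crossMonochromaticPairs (C false) m<k)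
                  (fewerColoursThanParts⇒n*n≤crossMonochromaticPairs (C true) m<k) ⟩
    crossMonochromaticPairs (C false) + crossMonochromaticPairs (C true)
      ≤⟨ +-mono-≤ (crossPairs≤levelSum false) (crossPairs≤levelSum true) ⟩
    levelSum false degree + levelSum true degree
      ≡⟨ sumᴸ-allVertices degree ⟨
    sumᴸ (map degree (allVertices n k))
      ≡⟨ pairCount-double Mono (monochromaticEdges-sym (Eno x) col Eno-sym)
                          (λ u → cong (_∧ _) (Eno-irrefl u)) (allVertices n k) ⟨
    2 * edgeCount Mono
      ∎)
    where
    open ≤-Reasoning
    Mono : EdgeSet (Vertex n k)
    Mono = monochromaticEdges (Eno x) col
    degree : Vertex n k → ℕ
    degree u = countTrue (Mono u) (allVertices n k)
    C : Bool → Fin n → Fin k → Fin m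
    C t a i = col (vertexAt x t a i)
    cross⇒Mono : ∀ t a i b j → not (i ==F j) ∧ (C t a i ==F C t b j) ≡ true →
                 Mono (vertexAt x t a i) (vertexAt x t b j) ≡ true
    cross⇒Mono t a i b j cross = cong₂ _∧_
      (Eno-complete (vertexAt x t a i) (vertexAt x t b j)
        (toWitnessFalse {a? = i ≟F j} (Equivalence.from T-≡ (∧-conicalˡ _ _ cross)))
        (trans (level-vertexAt x t b j) (sym (level-vertexAt x t a i))))
      (∧-conicalʳ _ _ cross)
    crossPairs≤levelSum : ∀ t → crossMonochromaticPairs (C t) ≤ levelSum t degree
    crossPairs≤levelSum t = ∑∑-mono λ a i → begin
      ∑∑ (λ b j → 𝟙 (not (i ==F j) ∧ (C t a i ==F C t b j)))
        ≤⟨ ∑∑-mono (λ b j → 𝟙-mono (cross⇒Mono t a i b j)) ⟩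
      levelSum t (𝟙 ∘ Mono (vertexAt x t a i))
        ≤⟨ levelSum≤sumᴸ-allVertices (𝟙 ∘ Mono (vertexAt x t a i)) t ⟩
      sumᴸ (map (𝟙 ∘ Mono (vertexAt x t a i)) (allVertices n k))
        ≡⟨ countTrue≡sumᴸ (Mono (vertexAt x t a i)) (allVertices n k) ⟨
      degree (vertexAt x t a i)
        ∎

proposition4p5 : (n k : ℕ) → 1 ≤ n → 3 ≤ k → (x : Assignment n k) →
    Bipartite (Eyes x) ×
    ((E′ : EdgeSet (Vertex n k)) → Symmetric E′ → E′ ⊆E Eno x → Colorable (k ∸ 1) E′ →
      edgeCount (Eno x) ≤ k * k * edgeCount (Eno x ∖E E′))
proposition4p5 n k _ 3≤k x = Eyes-bipartite x , λ E′ _ _ (col , proper) → begin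
    edgeCount (Eno x)
      ≤⟨ edgeCount-Eno≤k*k*n*n x ⟩
    k * k * (n * n)
      ≤⟨ *-monoʳ-≤ (k * k) (n*n≤edgeCount-monochromaticEno x col k∸1<k) ⟩
    k * k * edgeCount (monochromaticEdges (Eno x) col)
      ≤⟨ *-monoʳ-≤ (k * k) (pairCount-mono (monochromaticEdges⊆∖ (Eno x) E′ col proper) (allVertices n k)) ⟩
    k * k * edgeCount (Eno x ∖E E′)
      ∎
  where
  open ≤-Reasoning
  k∸1<k : k ∸ 1 < k
  k∸1<k = ≤-reflexive (m+[n∸m]≡n (≤-trans (s≤s z≤n) 3≤k))
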